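{- Let $\mathcal{S}_0$ be a realizability structure. Then $\succ_{\mathcal{S}_0}$ is a multi-evaluation relation, and $\mathcal{S}_{\succ_{\mathcal{S}_0}}=\mathcal{S}_0$.
   Context: $\lambda_c$-calculus. Fix a countably infinite set of variables. $\lambda_c$-terms: $t,u ::= x \mid tu \mid \lambda x.t \mid \mathrm{cc} \mid k_\pi$ ($\pi$ a stack) $\mid \kappa_m$ ($m\in\mathbb{N}$) $\mid \beta_m$ ($m\in\mathbb{N}$), modulo $\alpha$-equivalence. A term is a closed $\lambda_c$-term. Stacks: $\pi ::= \omega_m \mid t\cdot\pi$ ($t$ a term). Processes: $t\star\pi$; let $\mathcal{P}r$ be the set of processes. One-step evaluation $\succ_1$ is the smallest relation on processes with $tu\star\pi \succ_1 t\star u\cdot\pi$, $\lambda x.t\star u\cdot\pi\succ_1 t[x:=u]\star\pi$, $\mathrm{cc}\star t\cdot\pi\succ_1 t\star k_\pi\cdot\pi$, $k_{\pi'}\star t\cdot\pi\succ_1 t\star\pi'$; $\succ$ its reflexive-transitive closure. A pole is a set $\perp\!\!\!\perp\subseteq\mathcal{P}r$ with $p\succ q$, $q\in\perp\!\!\!\perp\Rightarrow p\in\perp\!\!\!\perp$. A realizability structure is a set of poles. A multi-evaluation relation is a binary relation $\succ'$ on $\mathcal{P}(\mathcal{P}r)$ such that: $p\succ_1 q$ implies $\{p\}\succ'\{q\}$; $\{p\}\succ'\{p\}$ for every process $p$; (cut) if $P\succ' Q\cup\{r\}$ and $P'\cup\{r\}\succ' Q'$ then $P\cup P'\succ' Q\cup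 Q'$; (weakening) if $P\succ' Q$, $P\subseteq P'$, $Q\subseteq Q'$ then $P'\succ' Q'$. For a binary relation $\succ'$ on $\mathcal{P}(\mathcal{P}r)$, $\mathcal{S}_{\succ'}$ is the set of all poles $\perp\!\!\!\perp$ such that for all $P\succ' Q$, $Q\subseteq\perp\!\!\!\perp$ implies $P\cap\perp\!\!\!\perp\ne\emptyset$. For a realizability structure $\mathcal{S}$, $\succ_{\mathcal{S}}$ is the relation on $\mathcal{P}(\mathcal{P}r)$ with $P\succ_{\mathcal{S}}Q$ iff for all $\perp\!\!\!\perp\in\mathcal{S}$, $Q\subseteq\perp\!\!\!\perp$ implies $P\cap\perp\!\!\!\perp\ne\emptyset$. -}

module Defs where

open import Level using (0ℓ) renaming (suc to lsuc)
open import Data.Nat using (ℕ; suc)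
open import Data.Fin using (Fin; zero; suc)
open import Data.Product using (_×_; _,_; ∃)
open import Relation.Binary.PropositionalEquality using (_≡_)
open import Relation.Binary.Construct.Closure.ReflexiveTransitive using (Star)
open import Relation.Unary using (Pred; _⊆_; _∪_; _∩_; _∈_)

-- λc-terms with de Bruijn indices (so α-equivalence is syntactic equality).
mutual
  data Tm : ℕ → Set where
    var  : ∀ {n} → Fin n → Tm n
    app  : ∀ {n} → Tm n → Tm n → Tm n
    lam  : ∀ {n} → Tm (suc n) → Tm n
    cc   : ∀ {n} → Tm n
    kont : ∀ {n} → Stack → Tm n
    κ    : ∀ {n} → ℕ → Tm n
    β    : ∀ {n} → ℕ → Tm n

  data Stack : Set where
    ω   : ℕ → Stack
    _·_ : Tm 0 → Stack → Stack

infixr 5 _·_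

Term : Set
Term = Tm 0

ext : ∀ {m n} → (Fin m → Fin n) → Fin (suc m) → Fin (suc n)
ext ρ zero    = zero
ext ρ (suc i) = suc (ρ i)

rename : ∀ {m n} → (Fin m → Fin n) → Tm m → Tm n
rename ρ (var i)   = var (ρ i)
rename ρ (app t u) = app (rename ρ t) (rename ρ u)
rename ρ (lam t)   = lam (rename (ext ρ) t)
rename ρ cc        = cc
rename ρ (kont π)  = kont π
rename ρ (κ m)     = κ m
rename ρ (β m)     = β m

exts : ∀ {m n} → (Fin m → Tm n) → Fin (suc m) → Tm (suc n)
exts σ zero    = var zero
exts σ (suc i) = rename suc (σ i)

subst : ∀ {m n} → (Fin m → Tm n) → Tm m → Tm n
subst σ (var i)   = σ i
subst σ (app t u) = app (subst σ t) (subst σ u)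
subst σ (lam t)   = lam (subst (exts σ) t)
subst σ cc        = cc
subst σ (kont π)  = kont π
subst σ (κ m)     = κ m
subst σ (β m)     = β m

_[_] : Tm 1 → Term → Term
t [ u ] = subst σ t
  where
  σ : Fin 1 → Term
  σ zero = u

record Process : Set where
  constructor _⋆_
  field
    tm : Term
    st : Stack

data _≻₁_ : Process → Process → Set where
  push : ∀ {t u π}    → (app t u ⋆ π) ≻₁ (t ⋆ (u · π))
  grab : ∀ {t u π}    → (lam t ⋆ (u · π)) ≻₁ ((t [ u ]) ⋆ π)
  save : ∀ {t π}      → (cc ⋆ (t · π)) ≻₁ (t ⋆ (kont π · π))
  rest : ∀ {π' t π}   → (kont π' ⋆ (t · π)) ≻₁ (t ⋆ π')

_≻_ : Process → Process → Set
_≻_ = Star _≻₁_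

PSet : Set₁
PSet = Pred Process 0ℓ

IsPole : PSet → Set
IsPole ⊥⊥ = ∀ p q → p ≻ q → q ∈ ⊥⊥ → p ∈ ⊥⊥

PSetSet : Set₂
PSetSet = Pred PSet (lsuc 0ℓ)

IsRealizabilityStructure : PSetSet → Set₁
IsRealizabilityStructure S = ∀ ⊥⊥ → ⊥⊥ ∈ S → IsPole ⊥⊥

MRel : Set₂
MRel = PSet → PSet → Set₁

singleton : Process → PSet
singleton p = λ q → q ≡ p

Nonempty : PSet → Set
Nonempty P = ∃ λ p → p ∈ P

IsMultiEvaluation : MRel → Set₁
IsMultiEvaluation R =
    (∀ p q → p ≻₁ q → R (singleton p) (singleton q))
  × (∀ p → R (singleton p) (singleton p))
  × (∀ P Q P' Q' r → R P (Q ∪ singleton r) → R (P' ∪ singleton r) Q'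
       → R (P ∪ P') (Q ∪ Q'))
  × (∀ P Q P' Q' → R P Q → P ⊆ P' → Q ⊆ Q' → R P' Q')

S[_] : MRel → PSetSet
S[ R ] ⊥⊥ = IsPole ⊥⊥ × (∀ P Q → R P Q → Q ⊆ ⊥⊥ → Nonempty (P ∩ ⊥⊥))

≻[_] : PSetSet → MRel
≻[ S ] P Q = ∀ ⊥⊥ → ⊥⊥ ∈ S → Q ⊆ ⊥⊥ → Nonempty (P ∩ ⊥⊥)

-- sets are extensional: membership in S respects extensional equality
RespectsExt : PSetSet → Set₁
RespectsExt S = ∀ A B → A ⊆ B → B ⊆ A → A ∈ S → B ∈ S

module Submission where

-- The four multi-evaluation axioms are verified separately for ≻_S with S an
-- arbitrary set of sets of processes; only the one-step axiom needs S to
-- consist of poles, and only the cut rule needs excluded middle (to decide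
-- whether the cut process r lies in the pole).
--
-- For the converse, the key observation is that any
-- set ⊥⊥ outside S₀ is separated by the relation  ∁⊥⊥ ≻_{S₀} ⊥⊥ : every
-- ⊥⊥' ∈ S₀ containing ⊥⊥ must strictly contain it (by extensionality of S₀),
-- hence meets ∁⊥⊥.  A pole ⊥⊥ of S_{≻_{S₀}} would then meet ∁⊥⊥, which is
-- absurd; so ⊥⊥ ∉ S₀ is refuted and classically ⊥⊥ ∈ S₀.

open import Defs
open import Level using (Level; 0ℓ) renaming (suc to lsuc)
open import Data.Product using (_×_; _,_; ∃)
open import Data.Sum using (inj₁; inj₂)
open import Data.Empty using (⊥-elim)
open import Relation.Nullary using (yes; no; ¬_)
open import Relation.Unary using (_≐_; _⊆_; _∈_; _∉_; _∪_; ∁)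
open import Relation.Binary.PropositionalEquality using (refl)
open import Relation.Binary.Construct.Closure.ReflexiveTransitive using (ε; _◅_)
open import Axiom.ExcludedMiddle using (ExcludedMiddle)
open import Axiom.DoubleNegationElimination using (em⇒dne)

¬⊆⇒witness : ExcludedMiddle 0ℓ → (A B : PSet) → ¬ (A ⊆ B) → ∃ λ p → p ∈ A × p ∉ B
¬⊆⇒witness em A B A⊈B with em {∃ λ p → p ∈ A × p ∉ B}
... | yes witness = witness
... | no none     = ⊥-elim (A⊈B A⊆B)
  where
  A⊆B : A ⊆ B
  A⊆B {p} p∈A with em {p ∈ B}
  ... | yes p∈B = p∈B
  ... | no  p∉B = ⊥-elim (none (p , p∈A , p∉B))

module _ (S : PSetSet) where

  ≻S-refl : ∀ p → ≻[ S ] (singleton p) (singleton p)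
  ≻S-refl p ⊥⊥ _ p∈⊥⊥ = p , refl , p∈⊥⊥ refl

  ≻S-eval : IsRealizabilityStructure S
    → ∀ p q → p ≻ q → ≻[ S ] (singleton p) (singleton q)
  ≻S-eval poles p q p≻q ⊥⊥ ⊥⊥∈S q∈⊥⊥ = p , refl , poles ⊥⊥ ⊥⊥∈S p q p≻q (q∈⊥⊥ refl)

  ≻S-weaken : ∀ P Q P' Q' → ≻[ S ] P Q → P ⊆ P' → Q ⊆ Q' → ≻[ S ] P' Q'
  ≻S-weaken P Q P' Q' P≻Q P⊆P' Q⊆Q' ⊥⊥ ⊥⊥∈S Q'⊆⊥⊥ with P≻Q ⊥⊥ ⊥⊥∈S (λ x → Q'⊆⊥⊥ (Q⊆Q' x))
  ... | p , p∈P , p∈⊥⊥ = p , P⊆P' p∈P , p∈⊥⊥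

  -- Cut: split on whether the cut process r lies in the pole.  If it does,
  -- the first premise applies; otherwise the second premise yields a process
  -- of P' ∪ {r} in the pole, which cannot be r.
  ≻S-cut : ExcludedMiddle 0ℓ → ∀ P Q P' Q' r
    → ≻[ S ] P (Q ∪ singleton r) → ≻[ S ] (P' ∪ singleton r) Q'
    → ≻[ S ] (P ∪ P') (Q ∪ Q')
  ≻S-cut em P Q P' Q' r left right ⊥⊥ ⊥⊥∈S QQ'⊆⊥⊥ with em {r ∈ ⊥⊥}
  ... | yes r∈⊥⊥ with left ⊥⊥ ⊥⊥∈S (λ { (inj₁ q∈Q) → QQ'⊆⊥⊥ (inj₁ q∈Q) ; (inj₂ refl) → r∈⊥⊥ })
  ...   | p , p∈P , p∈⊥⊥ = p , inj₁ p∈P , p∈⊥⊥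
  ≻S-cut em P Q P' Q' r left right ⊥⊥ ⊥⊥∈S QQ'⊆⊥⊥ | no r∉⊥⊥
        with right ⊥⊥ ⊥⊥∈S (λ q∈Q' → QQ'⊆⊥⊥ (inj₂ q∈Q'))
  ...   | p , inj₁ p∈P' , p∈⊥⊥ = p , inj₂ p∈P' , p∈⊥⊥
  ...   | p , inj₂ refl , p∈⊥⊥ = ⊥-elim (r∉⊥⊥ p∈⊥⊥)

  ≻S-multiEvaluation : ExcludedMiddle 0ℓ → IsRealizabilityStructure S
    → IsMultiEvaluation ≻[ S ]
  ≻S-multiEvaluation em poles =
      (λ p q p≻₁q → ≻S-eval poles p q (p≻₁q ◅ ε))
    , ≻S-refl
    , ≻S-cut em
    , ≻S-weaken

  S⊆S[≻S] : IsRealizabilityStructure S → S ⊆ S[ ≻[ S ] ]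
  S⊆S[≻S] poles {⊥⊥} ⊥⊥∈S = poles ⊥⊥ ⊥⊥∈S , λ P Q P≻Q Q⊆⊥⊥ → P≻Q ⊥⊥ ⊥⊥∈S Q⊆⊥⊥

  -- A set ⊥⊥ outside an extensional S is separated: ∁⊥⊥ ≻_S ⊥⊥.  Any
  -- ⊥⊥' ∈ S above ⊥⊥ cannot lie below ⊥⊥ as well, so it meets ∁⊥⊥.
  separate : ExcludedMiddle 0ℓ → RespectsExt S
    → ∀ ⊥⊥ → ⊥⊥ ∉ S → ≻[ S ] (∁ ⊥⊥) ⊥⊥
  separate em ext ⊥⊥ ⊥⊥∉S ⊥⊥' ⊥⊥'∈S ⊥⊥⊆⊥⊥' with ¬⊆⇒witness em ⊥⊥' ⊥⊥ ⊥⊥'⊈⊥⊥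
    where
    ⊥⊥'⊈⊥⊥ : ¬ (⊥⊥' ⊆ ⊥⊥)
    ⊥⊥'⊈⊥⊥ ⊥⊥'⊆⊥⊥ = ⊥⊥∉S (ext ⊥⊥' ⊥⊥ ⊥⊥'⊆⊥⊥ ⊥⊥⊆⊥⊥' ⊥⊥'∈S)
  ... | p , p∈⊥⊥' , p∉⊥⊥ = p , p∉⊥⊥ , p∈⊥⊥'

  -- Conversely, S_{≻_S} ⊆ S: a member ⊥⊥ ∉ S would, applied to the separating
  -- instance ∁⊥⊥ ≻_S ⊥⊥, contain a process outside itself.
  S[≻S]⊆S : ExcludedMiddle 0ℓ → ExcludedMiddle (lsuc 0ℓ) → RespectsExt S
    → S[ ≻[ S ] ] ⊆ S
  S[≻S]⊆S em em₁ ext {⊥⊥} (_ , sound) = em⇒dne em₁ ⊥⊥∉S-absurd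
    where
    ⊥⊥∉S-absurd : ¬ (⊥⊥ ∉ S)
    ⊥⊥∉S-absurd ⊥⊥∉S with sound (∁ ⊥⊥) ⊥⊥ (separate em ext ⊥⊥ ⊥⊥∉S) (λ p∈⊥⊥ → p∈⊥⊥)
    ... | p , p∉⊥⊥ , p∈⊥⊥ = p∉⊥⊥ p∈⊥⊥

mainTheorem11 : (lem : ∀ {ℓ : Level} → ExcludedMiddle ℓ)
    → (S₀ : PSetSet) → IsRealizabilityStructure S₀ → RespectsExt S₀
    → IsMultiEvaluation ≻[ S₀ ] × (S[ ≻[ S₀ ] ] ≐ S₀)
mainTheorem11 lem S₀ poles ext =
    ≻S-multiEvaluation S₀ lem poles
  , (S[≻S]⊆S S₀ lem lem ext , S⊆S[≻S] S₀ poles)
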